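{- Let $\mathcal{H}=(V,E,<)$ be an ordered triple system with the upper sum property, let $k\ge 2$, and let $\mathcal{Q}$ be a $k$-bicycle contained in $\mathcal{H}$, with antipodes $a$ and $b$. Then the two largest vertices of $\mathcal{Q}$ (with respect to $<$) are not its two antipodes; that is, it is not the case that $a$ and $b$ are the two maximal vertices of $\mathcal{Q}$.
   Context: An ordered triple system is a triple $\mathcal{H}=(V,E,<)$ where $V$ is a set, $E\subseteq\binom{V}{3}$ is a family of unordered $3$-element subsets (edges), and $<$ is a total order on $V$. $\mathcal{H}$ has the upper sum property if, whenever $\{a,b,c\}$ and $\{a,b',c'\}$ are two edges whose maxima (with respect to $<$) are $c$ and $c'$ respectively, $b>b'$ implies $c>c'$. For $k\ge 2$, the $k$-bicycle is the triple system whose vertex set is $\mathbb{Z}_{2k}\cup\{a,b\}$ ($a,b$ two extra vertices called antipodes) and whose edges are all triples $\{a,2j,2j+1\}$ and $\{b,2j-1,2j\}$ for $0\le j<k$, with arithmetic in $\mathbb{Z}_{2k}$. A $k$-bicycle contained in $\mathcal{H}$ means a set of $2k+2$ vertices of $\mathcal{H}$ together with an identification with the vertices of the $k$-bicycle such that every edge of the $k$-bicycle is an edge of $\mathcal{H}$; its antipodes are the vertices identified with $a$ and $b$. -}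

module Defs where

open import Level using (0ℓ)
open import Data.Nat using (ℕ; zero; suc; _+_; _*_)
open import Data.Nat.DivMod using (_mod_)
open import Data.Fin using (Fin; toℕ)
open import Data.Product using (_×_)
open import Relation.Binary.Core using (Rel)
open import Relation.Binary.Structures using (IsStrictTotalOrder)
open import Relation.Binary.PropositionalEquality using (_≡_; _≢_)
open import Function.Definitions using (Injective)

-- Edges are given by a predicate E x y z meaning "{x,y,z} is an edge";
-- it is required to be invariant under permutations (so it really is a
-- predicate on unordered triples) and to hold only for 3-element sets.
record OrderedTripleSystem : Set₁ where
  field
    V       : Set
    _<_     : Rel V 0ℓ
    isSTO   : IsStrictTotalOrder _≡_ _<_
    E       : V → V → V → Set
    E-swap₁ : ∀ {x y z} → E x y z → E y x z
    E-swap₂ : ∀ {x y z} → E x y z → E x z y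
    E-dist₁ : ∀ {x y z} → E x y z → x ≢ y
    E-dist₂ : ∀ {x y z} → E x y z → x ≢ z
    E-dist₃ : ∀ {x y z} → E x y z → y ≢ z

module _ (H : OrderedTripleSystem) where
  open OrderedTripleSystem H

  EdgeMax : V → V → V → Set
  EdgeMax a b c = E a b c × a < c × b < c

  UpperSum : Set
  UpperSum = ∀ {a b c b' c'} → EdgeMax a b c → EdgeMax a b' c' → b' < b → c' < c

  -- index i (a natural number) reduced into ℤ_{2k}; the argument j : Fin k
  -- only witnesses k ≥ 1 so that the modulus is nonzero.
  ix : ∀ {k} → Fin k → ℕ → Fin (k + k)
  ix {suc k} _ i = i mod (suc k + suc k)

  -- A k-bicycle contained in H: cycle vertices cyc : ℤ_{2k} → V, antipodes
  -- apA, apB, all 2k+2 vertices distinct, and the edges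
  -- {a,2j,2j+1}, {b,2j-1,2j} for 0 ≤ j < k (indices mod 2k).
  record Bicycle (k : ℕ) : Set where
    field
      cyc   : Fin (k + k) → V
      apA   : V
      apB   : V
      cyc-inj : Injective _≡_ _≡_ cyc
      ab-dist : apA ≢ apB
      a-dist  : ∀ i → apA ≢ cyc i
      b-dist  : ∀ i → apB ≢ cyc i
      edgeA : ∀ (j : Fin k) →
        E apA (cyc (ix j (2 * toℕ j))) (cyc (ix j (suc (2 * toℕ j))))
      edgeB : ∀ (j : Fin k) →
        E apB (cyc (ix j (2 * toℕ j + (k + k) Data.Nat.∸ 1))) (cyc (ix j (2 * toℕ j)))

  AntipodesLargest : ∀ {k} → Bicycle k → Set
  AntipodesLargest {k} Q = ∀ (i : Fin (k + k)) → (cyc i < apA) × (cyc i < apB)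
    where open Bicycle Q

-- If the antipodes a and b are the two largest vertices, every edge of the bicycle has an
-- antipode as its maximum. The edges {c₂ⱼ, c₂ⱼ₊₁, a} and {c₂ⱼ, c₂ⱼ₋₁, b} share c₂ⱼ, so by the
-- upper sum property c₂ⱼ₊₁ and c₂ⱼ₋₁ compare (weakly) the same way as a and b. If a < b the odd
-- vertices therefore descend weakly around the cycle, c₋₁ ≥ c₁ ≥ … ≥ c₂ₖ₋₁ = c₋₁, which forces
-- c₁ = c₋₁; for k ≥ 2 these are distinct vertices. The case b < a is the same in the reversed order.
module Submission where

open import Defs
open import Data.Nat using (ℕ; _≤_)
open import Relation.Nullary using (¬_)

open import Relation.Nullary using (contradiction)
open import Data.Nat using (NonZero; suc; _+_; _*_; _∸_; _<_; _≤′_; ≤′-refl; ≤′-step; s≤s; z≤n)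
open import Data.Nat.Properties
  using (*-suc; +-identityʳ; <⇒≤; ≤⇒≤′; ≤-refl; ≤-trans; n<1+n; m≤m+n; m+1+n≢0; suc-injective)
open import Data.Nat.DivMod using (_mod_; _%_; [m+n]%n≡m%n; m<n⇒m%n≡m)
open import Data.Fin using (toℕ; fromℕ<)
open import Data.Fin.Properties using (fromℕ<-cong; toℕ-fromℕ<)
open import Data.Product using (_,_; proj₁; proj₂)
open import Data.Sum using (inj₁; inj₂)
open import Function using (_∘_)
open import Relation.Binary.Bundles using (Poset; StrictTotalOrder)
open import Relation.Binary.Definitions using (tri<; tri≈; tri>)
open import Relation.Binary.PropositionalEquality
  using (_≡_; _≢_; sym; trans; cong; subst; module ≡-Reasoning)
import Relation.Binary.Properties.Poset as PosetProperties
import Relation.Binary.Properties.StrictTotalOrder as StrictTotalOrderProperties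

module _ {a ℓ₁ ℓ₂} (P : Poset a ℓ₁ ℓ₂) where
  open Poset P using (Carrier; _≈_; antisym; ≤-respˡ-≈)
    renaming (_≤_ to _≼_; refl to ≼-refl; trans to ≼-trans)

  module _ {f : ℕ → Carrier} {k : ℕ} (descending : ∀ {j} → j < k → f (suc j) ≼ f j) where

    descending⇒f[j]≼f[i] : ∀ {i j} → i ≤′ j → j ≤ k → f j ≼ f i
    descending⇒f[j]≼f[i] ≤′-refl         _   = ≼-refl
    descending⇒f[j]≼f[i] (≤′-step i≤′j) j<k =
      ≼-trans (descending j<k) (descending⇒f[j]≼f[i] i≤′j (<⇒≤ j<k))

    descending∧f[k]≈f[0]⇒f[1]≈f[0] : 1 ≤ k → f k ≈ f 0 → f 1 ≈ f 0
    descending∧f[k]≈f[0]⇒f[1]≈f[0] 1≤k fk≈f0 =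
      antisym (descending 1≤k) (≤-respˡ-≈ fk≈f0 (descending⇒f[j]≼f[i] (≤⇒≤′ 1≤k) ≤-refl))

module _ {d : ℕ} .{{_ : NonZero d}} where

  mod-cong : ∀ m n → m % d ≡ n % d → m mod d ≡ n mod d
  mod-cong m n eq = fromℕ<-cong _ _ eq _ _

  mod-injective : ∀ {m n} → m < d → n < d → m mod d ≡ n mod d → m ≡ n
  mod-injective {m} {n} m<d n<d eq = begin
    m               ≡⟨ m<n⇒m%n≡m m<d ⟨
    m % d           ≡⟨ toℕ-fromℕ< _ ⟨
    toℕ (m mod d)   ≡⟨ cong toℕ eq ⟩
    toℕ (n mod d)   ≡⟨ toℕ-fromℕ< _ ⟩
    n % d           ≡⟨ m<n⇒m%n≡m n<d ⟩
    n               ∎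
    where open ≡-Reasoning

1≢n+1+n : ∀ {n} → 1 ≤ n → 1 ≢ n + suc n
1≢n+1+n {suc m} _ eq = m+1+n≢0 m (sym (suc-injective eq))

module _ (H : OrderedTripleSystem) where
  open OrderedTripleSystem H renaming (_<_ to _≺_)

  strictTotalOrder : StrictTotalOrder _ _ _
  strictTotalOrder = record { isStrictTotalOrder = isSTO }

  open StrictTotalOrder strictTotalOrder using (compare; asym)
  open StrictTotalOrderProperties strictTotalOrder public using (poset)
  open StrictTotalOrderProperties strictTotalOrder using () renaming (_≤_ to _≼_)

  E-rotate : ∀ {x y z} → E x y z → E y z x
  E-rotate = E-swap₂ ∘ E-swap₁

  upperSum⇒≼ : UpperSum H → ∀ {x y c y' c'} →
    EdgeMax H x y c → EdgeMax H x y' c' → c' ≺ c → y' ≼ y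
  upperSum⇒≼ upperSum {y = y} {y' = y'} e e' c'≺c with compare y' y
  ... | tri< y'≺y _ _ = inj₁ y'≺y
  ... | tri≈ _ y'≡y _ = inj₂ y'≡y
  ... | tri> _ _ y≺y' = contradiction (upperSum e' e y≺y') (asym c'≺c)

  module _ {n : ℕ} (Q : Bicycle H (suc n)) where
    open Bicycle Q

    private
      K : ℕ
      K = suc n + suc n

    -- odd-vertex j is c₂ⱼ₋₁, indexed as in edgeB, so odd-vertex 0 is c₂ₖ₋₁ and odd-vertex k is c₄ₖ₋₁ = c₂ₖ₋₁.
    even-vertex odd-vertex : ℕ → V
    even-vertex j = cyc ((2 * j) mod K)
    odd-vertex  j = cyc ((2 * j + K ∸ 1) mod K)

    odd-vertex-suc : ∀ j → odd-vertex (suc j) ≡ cyc (suc (2 * j) mod K)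
    odd-vertex-suc j = cong cyc (mod-cong (2 * suc j + K ∸ 1) (suc (2 * j)) (begin
      (2 * suc j + K ∸ 1) % K  ≡⟨ cong (λ i → (i + K ∸ 1) % K) (*-suc 2 j) ⟩
      (suc (2 * j) + K) % K    ≡⟨ [m+n]%n≡m%n (suc (2 * j)) K ⟩
      suc (2 * j) % K          ∎))
      where open ≡-Reasoning

    odd-vertex-wrap : odd-vertex (suc n) ≡ odd-vertex 0
    odd-vertex-wrap = cong cyc (mod-cong (2 * suc n + K ∸ 1) (K ∸ 1) (begin
      (2 * suc n + K ∸ 1) % K  ≡⟨ cong (λ i → (suc n + i + K ∸ 1) % K) (+-identityʳ (suc n)) ⟩
      (K ∸ 1 + K) % K          ≡⟨ [m+n]%n≡m%n (K ∸ 1) K ⟩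
      (K ∸ 1) % K              ∎))
      where open ≡-Reasoning

    odd-vertex-1≢0 : 1 ≤ n → odd-vertex 1 ≢ odd-vertex 0
    odd-vertex-1≢0 1≤n eq = 1≢n+1+n 1≤n (mod-injective 1<K (n<1+n (K ∸ 1))
      (cyc-inj (trans (sym (odd-vertex-suc 0)) eq)))
      where
      1<K : 1 < K
      1<K = s≤s (≤-trans 1≤n (m≤m+n n (suc n)))

    edgeA-at : ∀ {j} → j < suc n → E apA (even-vertex j) (odd-vertex (suc j))
    edgeA-at {j} j<k = subst (E apA (even-vertex j)) (sym (odd-vertex-suc j))
      (subst (λ i → E apA (even-vertex i) (cyc (suc (2 * i) mod K)))
             (toℕ-fromℕ< j<k) (edgeA (fromℕ< j<k)))

    edgeB-at : ∀ {j} → j < suc n → E apB (odd-vertex j) (even-vertex j)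
    edgeB-at {j} j<k = subst (λ i → E apB (odd-vertex i) (even-vertex i))
      (toℕ-fromℕ< j<k) (edgeB (fromℕ< j<k))

    module _ (largest : AntipodesLargest H Q) where

      edgeMaxA : ∀ {j} → j < suc n → EdgeMax H (even-vertex j) (odd-vertex (suc j)) apA
      edgeMaxA j<k = E-rotate (edgeA-at j<k) , proj₁ (largest _) , proj₁ (largest _)

      edgeMaxB : ∀ {j} → j < suc n → EdgeMax H (even-vertex j) (odd-vertex j) apB
      edgeMaxB j<k = E-swap₁ (E-rotate (edgeB-at j<k)) , proj₂ (largest _) , proj₂ (largest _)

proposition1 : (H : OrderedTripleSystem) → UpperSum H → (k : ℕ) → 2 ≤ k →
    (Q : Bicycle H k) → ¬ AntipodesLargest H Q
proposition1 H upperSum (suc n) (s≤s 1≤n) Q largest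
  with StrictTotalOrder.compare (strictTotalOrder H) (Bicycle.apA Q) (Bicycle.apB Q)
... | tri≈ _ a≡b _ = Bicycle.ab-dist Q a≡b
... | tri< a≺b _ _ = odd-vertex-1≢0 H Q 1≤n
  (descending∧f[k]≈f[0]⇒f[1]≈f[0] (poset H)
    (λ j<k → upperSum⇒≼ H upperSum (edgeMaxB H Q largest j<k) (edgeMaxA H Q largest j<k) a≺b)
    (s≤s z≤n) (odd-vertex-wrap H Q))
... | tri> _ _ b≺a = odd-vertex-1≢0 H Q 1≤n
  (descending∧f[k]≈f[0]⇒f[1]≈f[0] (PosetProperties.≥-poset (poset H))
    (λ j<k → upperSum⇒≼ H upperSum (edgeMaxA H Q largest j<k) (edgeMaxB H Q largest j<k) b≺a)
    (s≤s z≤n) (odd-vertex-wrap H Q))
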